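{- For every first-order formula $\varphi$ of the language of group theory and every assignment $e:\{x_1,x_2,\dots\}\to\mathbb N$ of its variables, the set $\mathcal S_{\varphi[e]}=\{G\in\mathcal G:\ \overline G\models\varphi[e]\}$ is Borel in $\mathcal G$. Consequently, for every sentence $\varphi$, the set $\{G\in\mathcal G:\ \overline G\models\varphi\}$ is either meager or comeager in $\mathcal G$.
   Context: Let $\mathbb N=\{1,2,3,\dots\}$. Equip $\mathbb N^{\mathbb N\times\mathbb N}$ with the product of the discrete topologies. Let $\mathcal G$ be the subspace consisting of tables that are the multiplication table of a group on $\mathbb N$ with identity element $1$ (subspace topology). For $G\in\mathcal G$, $\overline G$ denotes the group on $\mathbb N$ with multiplication table $G$. The language of group theory has a binary function symbol for multiplication and a constant symbol $1$, interpreted in $\overline G$ by $G$ and the element $1$. -}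

module Defs where

open import Data.Nat using (ℕ; zero; suc; _≟_)
open import Data.Product using (Σ; _×_; _,_)
open import Data.Sum using (_⊎_)
open import Data.Empty using (⊥)
open import Data.List using (List; []; _∷_; _++_)
open import Data.List.Relation.Unary.All using (All)
open import Relation.Nullary using (¬_; yes; no)
open import Relation.Binary.PropositionalEquality using (_≡_)
open import Function.Bundles using (_⇔_)

-- Coding: the paper's ℕ = {1,2,3,...} is coded by Agda's ℕ via n ↦ n-1.
-- So paper element k is Agda element k-1; the identity "1" is code 0.

Table : Set
Table = ℕ → ℕ → ℕ

e₁ : ℕ
e₁ = 0

record IsGroupTable (G : Table) : Set where
  field
    assoc : ∀ x y z → G (G x y) z ≡ G x (G y z)
    idˡ   : ∀ x → G e₁ x ≡ x
    idʳ   : ∀ x → G x e₁ ≡ x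
    inv   : ∀ x → Σ ℕ (λ y → G x y ≡ e₁ × G y x ≡ e₁)

-- Borel sets of the ambient product space ℕ^(ℕ×ℕ) (discrete factors):
-- the σ-algebra generated by the subbasic cylinders {G | G i j ≡ k}.
-- (Every open set is a countable union of finite intersections of these.)

data Borel : (Table → Set) → Set₁ where
  cyl   : ∀ i j k → Borel (λ G → G i j ≡ k)
  compl : ∀ {A} → Borel A → Borel (λ G → ¬ A G)
  ⋃     : (A : ℕ → Table → Set) → (∀ n → Borel (A n)) →
          Borel (λ G → Σ ℕ (λ n → A n G))
  ⋂     : (A : ℕ → Table → Set) → (∀ n → Borel (A n)) →
          Borel (λ G → ∀ n → A n G)
  ext   : ∀ {A B} → Borel A → (∀ G → A G ⇔ B G) → Borel B

BorelIn𝒢 : (Table → Set) → Set₁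
BorelIn𝒢 S = Σ (Table → Set) (λ B → Borel B × (∀ G → IsGroupTable G → (S G ⇔ B G)))

-- Baire category in the subspace 𝒢.
-- Basic open sets of 𝒢: {G ∈ 𝒢 | G i j ≡ k for all (i,j,k) in c},
-- c a finite list of constraints.

Constraint : Set
Constraint = ℕ × ℕ × ℕ

Meets : List Constraint → Table → Set
Meets c G = All (λ { (i , j , k) → G i j ≡ k }) c

NonEmptyIn𝒢 : List Constraint → Set
NonEmptyIn𝒢 c = Σ Table (λ G → IsGroupTable G × Meets c G)

NowhereDense : (Table → Set) → Set
NowhereDense A =
  ∀ c → NonEmptyIn𝒢 c →
  Σ (List Constraint) (λ d →
    NonEmptyIn𝒢 (d ++ c) ×
    (∀ G → IsGroupTable G → Meets (d ++ c) G → ¬ A G))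

Meager : (Table → Set) → Set₁
Meager A =
  Σ (ℕ → Table → Set) (λ N →
    (∀ n → NowhereDense (N n)) ×
    (∀ G → IsGroupTable G → A G → Σ ℕ (λ n → N n G)))

Comeager : (Table → Set) → Set₁
Comeager A = Meager (λ G → ¬ A G)

-- First-order language of group theory: binary ·, constant 1.
-- Variables x₁, x₂, ... are indexed by ℕ (x_{n+1} ↦ n).

data Term : Set where
  var  : ℕ → Term
  one  : Term
  _·_  : Term → Term → Term

data Formula : Set where
  _≐_  : Term → Term → Formula
  ⊥f   : Formula
  ¬f_  : Formula → Formula
  _∧f_ : Formula → Formula → Formula
  _∨f_ : Formula → Formula → Formula
  _⇒f_ : Formula → Formula → Formula
  ∀f   : ℕ → Formula → Formula
  ∃f   : ℕ → Formula → Formula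

Assignment : Set
Assignment = ℕ → ℕ

_[_↦_] : Assignment → ℕ → ℕ → Assignment
(e [ x ↦ a ]) y with y ≟ x
... | yes _ = a
... | no  _ = e y

⟦_⟧ : Term → Table → Assignment → ℕ
⟦ var x ⟧ G e = e x
⟦ one ⟧   G e = e₁
⟦ s · t ⟧ G e = G (⟦ s ⟧ G e) (⟦ t ⟧ G e)

Sat : Table → Assignment → Formula → Set
Sat G e (s ≐ t)   = ⟦ s ⟧ G e ≡ ⟦ t ⟧ G e
Sat G e ⊥f        = ⊥
Sat G e (¬f φ)    = ¬ Sat G e φ
Sat G e (φ ∧f ψ)  = Sat G e φ × Sat G e ψ
Sat G e (φ ∨f ψ)  = Sat G e φ ⊎ Sat G e ψ
Sat G e (φ ⇒f ψ)  = Sat G e φ → Sat G e ψ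
Sat G e (∀f x φ)  = ∀ a → Sat G (e [ x ↦ a ]) φ
Sat G e (∃f x φ)  = Σ ℕ (λ a → Sat G (e [ x ↦ a ]) φ)

OccursIn : ℕ → Term → Set
OccursIn x (var y) = x ≡ y
OccursIn x one     = ⊥
OccursIn x (s · t) = OccursIn x s ⊎ OccursIn x t

FreeIn : ℕ → Formula → Set
FreeIn x (s ≐ t)  = OccursIn x s ⊎ OccursIn x t
FreeIn x ⊥f       = ⊥
FreeIn x (¬f φ)   = FreeIn x φ
FreeIn x (φ ∧f ψ) = FreeIn x φ ⊎ FreeIn x ψ
FreeIn x (φ ∨f ψ) = FreeIn x φ ⊎ FreeIn x ψ
FreeIn x (φ ⇒f ψ) = FreeIn x φ ⊎ FreeIn x ψ
FreeIn x (∀f y φ) = ¬ (x ≡ y) × FreeIn x φ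
FreeIn x (∃f y φ) = ¬ (x ≡ y) × FreeIn x φ

Sentence : Formula → Set
Sentence φ = ∀ x → ¬ FreeIn x φ

-- Ḡ ⊨ φ for a sentence φ (the assignment is irrelevant; we use the constant 1)
Models : Table → Formula → Set
Models G φ = Sat G (λ _ → e₁) φ

-- classical logic, assumed explicitly (the paper reasons classically)
LEM : Set₁
LEM = (P : Set) → P ⊎ ¬ P

{-# OPTIONS --safe #-}
-- The satisfaction set of a formula is assembled from the cylinders G i j ≡ k by
-- the countable Borel operations, following the structure of the formula.
-- For the zero-one law: Borel sets have the Baire property, and the set of models
-- of φ is invariant under relabelling ℕ by permutations fixing the identity. If
-- that set is not meager, it is comeager in some nonempty basic open set [ c ];
-- relabelling carries this to shifted copies of [ c ], and the union of these
-- copies is dense, because a shift of c and any satisfiable c′ can be realised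
-- together in a suitably relabelled direct product of a witness of c and one of c′.
module Submission where

open import Defs
open import Data.Nat using (ℕ; zero; suc; _+_; _∸_; _≤_; _<_; _≟_; _≤?_; z≤n; s≤s)
open import Data.Nat.Properties
  using (+-suc; +-comm; +-identityʳ; ≤-refl; ≤-trans; ≤-pred; <⇒≤; <-irrefl; ≰⇒>; +-monoˡ-≤;
         m≤n⇒m<n∨m≡n; m≤m+n; m≤n+m; m+n∸n≡m; m∸n+n≡m; m∸n≡0⇒m≤n)
open import Data.Product using (Σ; _×_; _,_; proj₁; proj₂)
open import Data.Product.Function.NonDependent.Propositional using (_×-⇔_)
open import Data.Product.Function.Dependent.Propositional using (Σ-⇔)
open import Data.Sum using (_⊎_; inj₁; inj₂)
open import Data.Sum.Function.Propositional using (_⊎-⇔_)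
open import Data.Empty using (⊥; ⊥-elim)
open import Data.List using (List; []; _∷_; _++_; map)
open import Data.List.Properties using (map-++; map-∘; map-cong; map-id)
open import Data.List.Relation.Unary.All using (All; []; _∷_; zip)
  renaming (map to All-map)
open import Data.List.Relation.Unary.All.Properties using (++⁺; ++⁻ˡ; map⁺; map⁻)
open import Relation.Nullary using (¬_; yes; no)
open import Relation.Binary.PropositionalEquality
  using (_≡_; refl; sym; trans; cong; cong₂; subst; subst₂; module ≡-Reasoning)
open import Function.Base using (id; _∘_)
open import Function.Bundles using (_⇔_; mk⇔; Equivalence; _↔_; mk↔ₛ′; Inverse; Injection)
open import Function.Properties.Inverse using (↔-refl; ↔-sym; ↔-trans; ↔⇒↠; ↔⇒↣)
open import Function.Related.TypeIsomorphisms using (→-cong-⇔; ¬-cong-⇔)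

open Inverse using (to; from; strictlyInverseˡ; strictlyInverseʳ)

borel-whole : Borel (λ G → Σ ℕ λ k → G 0 0 ≡ k)
borel-whole = ⋃ (λ k G → G 0 0 ≡ k) (cyl 0 0)

borel-const : LEM → (P : Set) → Borel (λ _ → P)
borel-const lem P with lem P
... | inj₁ p  = ext borel-whole (λ G → mk⇔ (λ _ → p) (λ _ → G 0 0 , refl))
... | inj₂ ¬p = ext (compl borel-whole) (λ G → mk⇔ (λ ¬v → ⊥-elim (¬v (G 0 0 , refl))) (⊥-elim ∘ ¬p))

borel-× : ∀ {A B} → Borel A → Borel B → Borel (λ G → A G × B G)
borel-× {A} {B} a b =
  ext (⋂ (λ { zero → A ; (suc _) → B }) (λ { zero → a ; (suc _) → b }))
      (λ G → mk⇔ (λ f → f 0 , f 1) (λ { (x , y) zero → x ; (x , y) (suc _) → y }))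

borel-⊎ : ∀ {A B} → Borel A → Borel B → Borel (λ G → A G ⊎ B G)
borel-⊎ {A} {B} a b =
  ext (⋃ (λ { zero → A ; (suc _) → B }) (λ { zero → a ; (suc _) → b }))
      (λ G → mk⇔ (λ { (zero , x) → inj₁ x ; (suc _ , y) → inj₂ y })
                 (λ { (inj₁ x) → 0 , x ; (inj₂ y) → 1 , y }))

borel-→ : LEM → ∀ {A B} → Borel A → Borel B → Borel (λ G → A G → B G)
borel-→ lem {A} {B} a b = ext (borel-⊎ (compl a) b) (λ G → mk⇔ implication (classical (lem (A G))))
  where
  implication : ∀ {G} → ¬ A G ⊎ B G → A G → B G
  implication (inj₁ ¬x) x = ⊥-elim (¬x x)
  implication (inj₂ y)  _ = y
  classical : ∀ {G} → A G ⊎ ¬ A G → (A G → B G) → ¬ A G ⊎ B G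
  classical (inj₁ x)  f = inj₂ (f x)
  classical (inj₂ ¬x) _ = inj₁ ¬x

borel-⟦⟧≡ : LEM → (t : Term) (e : Assignment) (k : ℕ) → Borel (λ G → ⟦ t ⟧ G e ≡ k)
borel-⟦⟧≡ lem (var x) e k = borel-const lem (e x ≡ k)
borel-⟦⟧≡ lem one     e k = borel-const lem (e₁ ≡ k)
borel-⟦⟧≡ lem (s · t) e k =
  ext (⋃ _ λ a → ⋃ _ λ b → borel-× (borel-× (borel-⟦⟧≡ lem s e a) (borel-⟦⟧≡ lem t e b)) (cyl a b k))
      (λ G → mk⇔ (λ { (_ , _ , (refl , refl) , st≡k) → st≡k }) (λ st≡k → _ , _ , (refl , refl) , st≡k))

borel-Sat : LEM → (φ : Formula) (e : Assignment) → Borel (λ G → Sat G e φ)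
borel-Sat lem (s ≐ t) e =
  ext (⋃ _ λ k → borel-× (borel-⟦⟧≡ lem s e k) (borel-⟦⟧≡ lem t e k))
      (λ G → mk⇔ (λ { (_ , s≡k , t≡k) → trans s≡k (sym t≡k) }) (λ s≡t → _ , s≡t , refl))
borel-Sat lem ⊥f       e = borel-const lem ⊥
borel-Sat lem (¬f φ)   e = compl (borel-Sat lem φ e)
borel-Sat lem (φ ∧f ψ) e = borel-× (borel-Sat lem φ e) (borel-Sat lem ψ e)
borel-Sat lem (φ ∨f ψ) e = borel-⊎ (borel-Sat lem φ e) (borel-Sat lem ψ e)
borel-Sat lem (φ ⇒f ψ) e = borel-→ lem (borel-Sat lem φ e) (borel-Sat lem ψ e)
borel-Sat lem (∀f x φ) e = ⋂ _ λ a → borel-Sat lem φ (e [ x ↦ a ])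
borel-Sat lem (∃f x φ) e = ⋃ _ λ a → borel-Sat lem φ (e [ x ↦ a ])

triangle : ℕ → ℕ
triangle zero    = zero
triangle (suc n) = suc n + triangle n

pair : ℕ → ℕ → ℕ
pair a b = triangle (a + b) + a

diagonalSuccessor : ℕ × ℕ → ℕ × ℕ
diagonalSuccessor (a , zero)  = 0 , suc a
diagonalSuccessor (a , suc b) = suc a , b

unpair : ℕ → ℕ × ℕ
unpair zero    = 0 , 0
unpair (suc n) = diagonalSuccessor (unpair n)

unpair₁ unpair₂ : ℕ → ℕ
unpair₁ = proj₁ ∘ unpair
unpair₂ = proj₂ ∘ unpair

pair-suc : ∀ a b → pair (suc a) b ≡ suc (pair a (suc b))
pair-suc a b rewrite +-suc a b | +-suc (triangle (suc (a + b))) a = refl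

pair-zero-suc : ∀ b → pair 0 (suc b) ≡ suc (pair b 0)
pair-zero-suc b rewrite +-identityʳ b | +-identityʳ (b + triangle b) = cong suc (+-comm b (triangle b))

unpair-pair : ∀ a b → unpair (pair a b) ≡ (a , b)
unpair-pair a b = go (a + b) a b refl
  where
  go : ∀ s a b → a + b ≡ s → unpair (pair a b) ≡ (a , b)
  go s       (suc a) b       a+b≡s = trans (cong unpair (pair-suc a b))
                                       (cong diagonalSuccessor (go s a (suc b) (trans (+-suc a b) a+b≡s)))
  go _       zero    zero    _     = refl
  go (suc s) zero    (suc b) refl  = trans (cong unpair (pair-zero-suc b))
                                       (cong diagonalSuccessor (go b b 0 (+-identityʳ b)))

unpair₁-pair : ∀ a b → unpair₁ (pair a b) ≡ a
unpair₁-pair a b = cong proj₁ (unpair-pair a b)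

unpair₂-pair : ∀ a b → unpair₂ (pair a b) ≡ b
unpair₂-pair a b = cong proj₂ (unpair-pair a b)

pair-unpair : ∀ x → pair (unpair₁ x) (unpair₂ x) ≡ x
pair-unpair zero = refl
pair-unpair (suc x) with unpair x | pair-unpair x
... | a , zero  | ih = trans (pair-zero-suc a) (cong suc ih)
... | a , suc b | ih = trans (pair-suc a b) (cong suc ih)

pair-injective : ∀ {a b c d} → pair a b ≡ pair c d → a ≡ c × b ≡ d
pair-injective {a} {b} {c} {d} eq =
  trans (sym (unpair₁-pair a b)) (trans (cong unpair₁ eq) (unpair₁-pair c d)) ,
  trans (sym (unpair₂-pair a b)) (trans (cong unpair₂ eq) (unpair₂-pair c d))

FixesIdentity : ℕ ↔ ℕ → Set
FixesIdentity p = to p e₁ ≡ e₁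

FixesIdentity-sym : ∀ {p} → FixesIdentity p → FixesIdentity (↔-sym p)
FixesIdentity-sym {p} fix = trans (cong (from p) (sym fix)) (strictlyInverseʳ p e₁)

transpose : ℕ → ℕ → ℕ → ℕ
transpose a b x with x ≟ a
... | yes _ = b
... | no  _ with x ≟ b
...   | yes _ = a
...   | no  _ = x

transpose-first : ∀ a b → transpose a b a ≡ b
transpose-first a b with a ≟ a
... | yes _  = refl
... | no a≢a = ⊥-elim (a≢a refl)

transpose-second : ∀ a b → transpose a b b ≡ a
transpose-second a b with b ≟ a
... | yes b≡a = b≡a
... | no  _ with b ≟ b
...   | yes _  = refl
...   | no b≢b = ⊥-elim (b≢b refl)

transpose-other : ∀ {a b x} → ¬ x ≡ a → ¬ x ≡ b → transpose a b x ≡ x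
transpose-other {a} {b} {x} x≢a x≢b with x ≟ a
... | yes x≡a = ⊥-elim (x≢a x≡a)
... | no  _ with x ≟ b
...   | yes x≡b = ⊥-elim (x≢b x≡b)
...   | no  _   = refl

transpose-involutive : ∀ a b x → transpose a b (transpose a b x) ≡ x
transpose-involutive a b x with x ≟ a
... | yes refl = transpose-second a b
... | no  x≢a with x ≟ b
...   | yes refl = transpose-first a b
...   | no  x≢b  = transpose-other x≢a x≢b

transposition : ℕ → ℕ → ℕ ↔ ℕ
transposition a b =
  mk↔ₛ′ (transpose a b) (transpose a b) (transpose-involutive a b) (transpose-involutive a b)

to-injective : (p : ℕ ↔ ℕ) → ∀ {x y} → to p x ≡ to p y → x ≡ y
to-injective p = Injection.injective (↔⇒↣ p)

InjectiveUpTo : ℕ → (ℕ → ℕ) → Set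
InjectiveUpTo n h = ∀ {i j} → i ≤ n → j ≤ n → h i ≡ h j → i ≡ j

-- After k steps the permutation agrees with h below k; step k composes with the
-- transposition of its current value at k and h k.
extend-injection : ∀ n (h : ℕ → ℕ) → InjectiveUpTo n h →
                   Σ (ℕ ↔ ℕ) λ p → ∀ {i} → i ≤ n → to p i ≡ h i
extend-injection n h h-inj = proj₁ (agreeBelow (suc n) ≤-refl) , proj₂ (agreeBelow (suc n) ≤-refl) ∘ s≤s
  where
  agreeBelow : ∀ k → k ≤ suc n → Σ (ℕ ↔ ℕ) λ p → ∀ {i} → i < k → to p i ≡ h i
  agreeBelow zero    _     = ↔-refl , λ ()
  agreeBelow (suc k) k<1+n = ↔-trans p (transposition (to p k) (h k)) , agree′
    where
    p = proj₁ (agreeBelow k (≤-trans (m≤n+m k 1) k<1+n))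
    agree = proj₂ (agreeBelow k (≤-trans (m≤n+m k 1) k<1+n))
    k≤n = ≤-pred k<1+n
    agree′ : ∀ {i} → i < suc k → transpose (to p k) (h k) (to p i) ≡ h i
    agree′ {i} i<1+k with m≤n⇒m<n∨m≡n (≤-pred i<1+k)
    ... | inj₂ refl = transpose-first (to p i) (h i)
    ... | inj₁ i<k  = trans (cong (transpose (to p k) (h k)) (agree i<k))
                            (transpose-other (λ hi≡pk → i≢k (to-injective p (trans (agree i<k) hi≡pk)))
                                             (i≢k ∘ h-inj (≤-trans (<⇒≤ i<k) k≤n) k≤n))
      where i≢k : ¬ i ≡ k
            i≢k refl = <-irrefl refl i<k

Π-⇔ : ∀ {I J : Set} {A : I → Set} {B : J → Set} (p : I ↔ J) →
      (∀ i → A i ⇔ B (to p i)) → (∀ i → A i) ⇔ (∀ j → B j)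
Π-⇔ {B = B} p A⇔B = mk⇔
  (λ f j → subst B (strictlyInverseˡ p j) (Equivalence.to (A⇔B (from p j)) (f (from p j))))
  (λ g i → Equivalence.from (A⇔B i) (g (to p i)))

-- to p is an isomorphism from act p G onto G.
act : ℕ ↔ ℕ → Table → Table
act p G i j = from p (G (to p i) (to p j))

module _ (p : ℕ ↔ ℕ) (fix : FixesIdentity p) where

  act-isGroupTable : ∀ {G} → IsGroupTable G → IsGroupTable (act p G)
  act-isGroupTable {G} grp = record
    { assoc = λ x y z → to-injective p (begin
        to p (act p G (act p G x y) z)     ≡⟨ to-act _ _ ⟩
        G (to p (act p G x y)) (to p z)    ≡⟨ cong (λ u → G u (to p z)) (to-act x y) ⟩
        G (G (to p x) (to p y)) (to p z)   ≡⟨ assoc _ _ _ ⟩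
        G (to p x) (G (to p y) (to p z))   ≡⟨ cong (G (to p x)) (to-act y z) ⟨
        G (to p x) (to p (act p G y z))    ≡⟨ to-act _ _ ⟨
        to p (act p G x (act p G y z))     ∎)
    ; idˡ = λ x → to-injective p (trans (to-act e₁ x) (trans (cong (λ u → G u (to p x)) fix) (idˡ (to p x))))
    ; idʳ = λ x → to-injective p (trans (to-act x e₁) (trans (cong (G (to p x)) fix) (idʳ (to p x))))
    ; inv = λ x → let (y , xy≡1 , yx≡1) = inv (to p x) in
        from p y ,
        to-injective p (trans (to-act x _) (trans (cong (G (to p x)) (strictlyInverseˡ p y)) (trans xy≡1 (sym fix)))) ,
        to-injective p (trans (to-act _ x) (trans (cong (λ u → G u (to p x)) (strictlyInverseˡ p y)) (trans yx≡1 (sym fix))))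
    }
    where
    open IsGroupTable grp
    open ≡-Reasoning
    to-act : ∀ i j → to p (act p G i j) ≡ G (to p i) (to p j)
    to-act i j = strictlyInverseˡ p _

  module _ (G : Table) where

    ⟦⟧-act : ∀ {e e′} → (∀ x → to p (e′ x) ≡ e x) → ∀ t → to p (⟦ t ⟧ (act p G) e′) ≡ ⟦ t ⟧ G e
    ⟦⟧-act e≈ (var x) = e≈ x
    ⟦⟧-act e≈ one     = fix
    ⟦⟧-act e≈ (s · t) = trans (strictlyInverseˡ p _) (cong₂ G (⟦⟧-act e≈ s) (⟦⟧-act e≈ t))

    update-act : ∀ {e e′} → (∀ x → to p (e′ x) ≡ e x) →
                 ∀ x a y → to p ((e′ [ x ↦ a ]) y) ≡ (e [ x ↦ to p a ]) y
    update-act e≈ x a y with y ≟ x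
    ... | yes _ = refl
    ... | no  _ = e≈ y

    Sat-act : ∀ {e e′} → (∀ x → to p (e′ x) ≡ e x) → ∀ φ → Sat (act p G) e′ φ ⇔ Sat G e φ
    Sat-act e≈ (s ≐ t)  = mk⇔ (λ eq → trans (sym (⟦⟧-act e≈ s)) (trans (cong (to p) eq) (⟦⟧-act e≈ t)))
                              (λ eq → to-injective p (trans (⟦⟧-act e≈ s) (trans eq (sym (⟦⟧-act e≈ t)))))
    Sat-act e≈ ⊥f       = mk⇔ id id
    Sat-act e≈ (¬f φ)   = ¬-cong-⇔ (Sat-act e≈ φ)
    Sat-act e≈ (φ ∧f ψ) = Sat-act e≈ φ ×-⇔ Sat-act e≈ ψ
    Sat-act e≈ (φ ∨f ψ) = Sat-act e≈ φ ⊎-⇔ Sat-act e≈ ψ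
    Sat-act e≈ (φ ⇒f ψ) = →-cong-⇔ (Sat-act e≈ φ) (Sat-act e≈ ψ)
    Sat-act e≈ (∀f x φ) = Π-⇔ p (λ a → Sat-act (update-act e≈ x a) φ)
    Sat-act e≈ (∃f x φ) = Σ-⇔ (↔⇒↠ p) (λ {a} → Sat-act (update-act e≈ x a) φ)

    Models-act : ∀ φ → Models (act p G) φ ⇔ Models G φ
    Models-act = Sat-act (λ _ → fix)

Holds : Table → Constraint → Set
Holds G (i , j , k) = G i j ≡ k

relabel : (ℕ → ℕ) → Constraint → Constraint
relabel f (i , j , k) = f i , f j , f k

map-relabel-inverse : ∀ {f g} → (∀ x → f (g x) ≡ x) → ∀ c → map (relabel f) (map (relabel g) c) ≡ c
map-relabel-inverse {f} {g} fg c = begin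
  map (relabel f) (map (relabel g) c)  ≡⟨ map-∘ c ⟨
  map (relabel f ∘ relabel g) c        ≡⟨ map-cong (λ (i , j , k) → cong₂ _,_ (fg i) (cong₂ _,_ (fg j) (fg k))) c ⟩
  map id c                             ≡⟨ map-id c ⟩
  c                                    ∎
  where open ≡-Reasoning

Meets-act : ∀ p G c → Meets c (act p G) ⇔ Meets (map (relabel (to p)) c) G
Meets-act p G c = mk⇔ (map⁺ ∘ All-map (Equivalence.to (holds _))) (All-map (Equivalence.from (holds _)) ∘ map⁻)
  where
  holds : ∀ t → Holds (act p G) t ⇔ Holds G (relabel (to p) t)
  holds (i , j , k) = mk⇔ (λ eq → trans (sym (strictlyInverseˡ p _)) (cong (to p) eq))
                          (λ eq → trans (cong (from p) eq) (strictlyInverseʳ p k))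

_⊆𝒢_ : (Table → Set) → (Table → Set) → Set
A ⊆𝒢 B = ∀ G → IsGroupTable G → A G → B G

meager-mono : ∀ {A B} → A ⊆𝒢 B → Meager B → Meager A
meager-mono A⊆B (N , nowhereDense , cover) = N , nowhereDense , λ G grp → cover G grp ∘ A⊆B G grp

meager-empty : ∀ {A} → (∀ G → IsGroupTable G → ¬ A G) → Meager A
meager-empty empty = (λ _ _ → ⊥) , (λ _ c ne → [] , ne , λ _ _ _ ()) , λ G grp a → ⊥-elim (empty G grp a)

nowhereDense⇒meager : ∀ {A} → NowhereDense A → Meager A
nowhereDense⇒meager {A} nowhereDense = (λ _ → A) , (λ _ → nowhereDense) , λ _ _ a → 0 , a

meager-⋃ : (A : ℕ → Table → Set) → (∀ n → Meager (A n)) → Meager (λ G → Σ ℕ λ n → A n G)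
meager-⋃ A meager = (λ k → N (unpair₁ k) (unpair₂ k)) ,
                    (λ k → proj₁ (proj₂ (meager (unpair₁ k))) (unpair₂ k)) ,
                    cover
  where
  N : ℕ → ℕ → Table → Set
  N n = proj₁ (meager n)
  cover : (λ G → Σ ℕ λ n → A n G) ⊆𝒢 (λ G → Σ ℕ λ k → N (unpair₁ k) (unpair₂ k) G)
  cover G grp (n , a) with proj₂ (proj₂ (meager n)) G grp a
  ... | m , x = pair n m , subst₂ (λ i j → N i j G) (sym (unpair₁-pair n m)) (sym (unpair₂-pair n m)) x

meager-∪ : ∀ {A B} → Meager A → Meager B → Meager (λ G → A G ⊎ B G)
meager-∪ {A} {B} meagerA meagerB =
  meager-mono (λ { _ _ (inj₁ a) → 0 , a ; _ _ (inj₂ b) → 1 , b })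
              (meager-⋃ (λ { zero → A ; (suc _) → B }) (λ { zero → meagerA ; (suc _) → meagerB }))

module _ (p : ℕ ↔ ℕ) (fix : FixesIdentity p) where

  nowhereDense-act : ∀ {A} → NowhereDense A → NowhereDense (A ∘ act p)
  nowhereDense-act nowhereDense c (H , H-grp , H⊨c)
    with nowhereDense (map (relabel (from p)) c) (act p H , act-isGroupTable p fix H-grp , act-H⊨)
    where
    act-H⊨ = Equivalence.from (Meets-act p H _) (subst (λ c → Meets c H) (sym (map-relabel-inverse (strictlyInverseˡ p) c)) H⊨c)
  ... | d , (K , K-grp , K⊨) , avoid =
    map (relabel (to p)) d , (act p⁻¹ K , act-isGroupTable p⁻¹ (FixesIdentity-sym {p} fix) K-grp , act-K⊨) , avoid′
    where
    p⁻¹ = ↔-sym p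
    open ≡-Reasoning
    act-K⊨ : Meets (map (relabel (to p)) d ++ c) (act p⁻¹ K)
    act-K⊨ = Equivalence.from (Meets-act p⁻¹ K _) (subst (λ c → Meets c K) (begin
      d ++ map (relabel (from p)) c                                       ≡⟨ cong (_++ _) (map-relabel-inverse (strictlyInverseʳ p) d) ⟨
      map (relabel (from p)) (map (relabel (to p)) d) ++ map (relabel (from p)) c ≡⟨ map-++ _ _ c ⟨
      map (relabel (from p)) (map (relabel (to p)) d ++ c)                ∎) K⊨)
    avoid′ : ∀ G → IsGroupTable G → Meets (map (relabel (to p)) d ++ c) G → ¬ _
    avoid′ G G-grp G⊨ = avoid (act p G) (act-isGroupTable p fix G-grp) (Equivalence.from (Meets-act p G _)
      (subst (λ c → Meets c G) (begin
        map (relabel (to p)) d ++ c                                         ≡⟨ cong (_ ++_) (map-relabel-inverse (strictlyInverseˡ p) c) ⟨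
        map (relabel (to p)) d ++ map (relabel (to p)) (map (relabel (from p)) c) ≡⟨ map-++ _ d _ ⟨
        map (relabel (to p)) (d ++ map (relabel (from p)) c)                ∎) G⊨))

  meager-act : ∀ {A} → Meager A → Meager (A ∘ act p)
  meager-act (N , nowhereDense , cover) =
    (λ n → N n ∘ act p) , (λ n → nowhereDense-act (nowhereDense n)) , λ G grp → cover (act p G) (act-isGroupTable p fix grp)

⋃Basic : (List Constraint → Set) → Table → Set
⋃Basic O G = Σ (List Constraint) λ c → O c × Meets c G

HasBaireProperty : (Table → Set) → Set₁
HasBaireProperty S = Σ (List Constraint → Set) λ O →
  Meager (λ G → S G × ¬ ⋃Basic O G) × Meager (λ G → ⋃Basic O G × ¬ S G)

baire-ext : ∀ {A B} → HasBaireProperty A → (∀ G → A G ⇔ B G) → HasBaireProperty B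
baire-ext (O , A∖U , U∖A) A⇔B =
  O , meager-mono (λ G _ (b , ¬u) → Equivalence.from (A⇔B G) b , ¬u) A∖U
    , meager-mono (λ G _ (u , ¬b) → u , ¬b ∘ Equivalence.to (A⇔B G)) U∖A

baire-cyl : ∀ i j k → HasBaireProperty (λ G → G i j ≡ k)
baire-cyl i j k = (_≡ (i , j , k) ∷ []) ,
  meager-empty (λ _ _ (Gij≡k , ¬u) → ¬u (_ , refl , Gij≡k ∷ [])) ,
  meager-empty (λ { _ _ ((_ , refl , Gij≡k ∷ []) , Gij≢k) → Gij≢k Gij≡k })

baire-⋃ : (A : ℕ → Table → Set) → (∀ n → HasBaireProperty (A n)) →
          HasBaireProperty (λ G → Σ ℕ λ n → A n G)
baire-⋃ A baire = (λ c → Σ ℕ λ n → O n c) ,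
  meager-mono (λ { _ _ ((n , a) , ¬u) → n , a , λ (c , oc , G⊨c) → ¬u (c , (n , oc) , G⊨c) })
              (meager-⋃ _ (λ n → proj₁ (proj₂ (baire n)))) ,
  meager-mono (λ { _ _ ((c , (n , oc) , G⊨c) , ¬a) → n , (c , oc , G⊨c) , λ a → ¬a (n , a) })
              (meager-⋃ _ (λ n → proj₂ (proj₂ (baire n))))
  where
  O : ℕ → List Constraint → Set
  O n = proj₁ (baire n)

-- O′ describes the interior of the complement of ⋃Basic O; what lies outside both
-- open sets is their common boundary, which is nowhere dense.
baire-¬ : LEM → ∀ {A} → HasBaireProperty A → HasBaireProperty (λ G → ¬ A G)
baire-¬ lem {A} (O , A∖U , U∖A) = O′ ,
  meager-mono split (meager-∪ U∖A (nowhereDense⇒meager boundary-nowhereDense)) ,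
  meager-mono inside-A A∖U
  where
  O′ : List Constraint → Set
  O′ c = NonEmptyIn𝒢 c × (∀ G → IsGroupTable G → Meets c G → ¬ ⋃Basic O G)

  Boundary : Table → Set
  Boundary G = ¬ ⋃Basic O G × ¬ ⋃Basic O′ G

  split : (λ G → ¬ A G × ¬ ⋃Basic O′ G) ⊆𝒢 (λ G → (⋃Basic O G × ¬ A G) ⊎ Boundary G)
  split G _ (¬a , ¬u′) with lem (⋃Basic O G)
  ... | inj₁ u  = inj₁ (u , ¬a)
  ... | inj₂ ¬u = inj₂ (¬u , ¬u′)

  inside-A : (λ G → ⋃Basic O′ G × ¬ ¬ A G) ⊆𝒢 (λ G → A G × ¬ ⋃Basic O G)
  inside-A G grp ((c , (_ , avoid) , G⊨c) , ¬¬a) with lem (A G)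
  ... | inj₁ a  = a , avoid G grp G⊨c
  ... | inj₂ ¬a = ⊥-elim (¬¬a ¬a)

  boundary-nowhereDense : NowhereDense Boundary
  boundary-nowhereDense c ne with lem (Σ Table λ G → IsGroupTable G × Meets c G × ⋃Basic O G)
  ... | inj₁ (G , grp , G⊨c , (c′ , oc′ , G⊨c′)) =
    c′ , (G , grp , ++⁺ G⊨c′ G⊨c) , λ _ _ H⊨ (¬u , _) → ¬u (c′ , oc′ , ++⁻ˡ c′ H⊨)
  ... | inj₂ none =
    [] , ne , λ _ _ H⊨c (_ , ¬u′) → ¬u′ (c , (ne , λ G grp G⊨c u → none (G , grp , G⊨c , u)) , H⊨c)

borel⇒baire : LEM → ∀ {A} → Borel A → HasBaireProperty A
borel⇒baire lem (cyl i j k)   = baire-cyl i j k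
borel⇒baire lem (compl b)     = baire-¬ lem (borel⇒baire lem b)
borel⇒baire lem (⋃ A b)       = baire-⋃ A (λ n → borel⇒baire lem (b n))
borel⇒baire lem (⋂ A b)       =
  baire-ext (baire-¬ lem (baire-⋃ (λ n G → ¬ A n G) (λ n → baire-¬ lem (borel⇒baire lem (b n)))))
            (λ G → mk⇔ (λ ¬∃¬a n → stable (A n G) (λ ¬a → ¬∃¬a (n , ¬a))) (λ ∀a (n , ¬a) → ¬a (∀a n)))
  where
  stable : (P : Set) → ¬ ¬ P → P
  stable P ¬¬p with lem P
  ... | inj₁ p  = p
  ... | inj₂ ¬p = ⊥-elim (¬¬p ¬p)
borel⇒baire lem (ext b A⇔B) = baire-ext (borel⇒baire lem b) A⇔B

product : Table → Table → Table
product G H x y = pair (G (unpair₁ x) (unpair₁ y)) (H (unpair₂ x) (unpair₂ y))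

product-pair : ∀ G H a b a′ b′ → product G H (pair a b) (pair a′ b′) ≡ pair (G a a′) (H b b′)
product-pair G H a b a′ b′
  rewrite unpair₁-pair a b | unpair₂-pair a b | unpair₁-pair a′ b′ | unpair₂-pair a′ b′ = refl

product-isGroupTable : ∀ {G H} → IsGroupTable G → IsGroupTable H → IsGroupTable (product G H)
product-isGroupTable {G} {H} G-grp H-grp = record
  { assoc = λ x y z → begin
      product G H (product G H x y) z                                  ≡⟨ inner-left x y z ⟩
      pair (G (G (x ₁) (y ₁)) (z ₁)) (H (H (x ₂) (y ₂)) (z ₂))       ≡⟨ cong₂ pair (G.assoc _ _ _) (H.assoc _ _ _) ⟩
      pair (G (x ₁) (G (y ₁) (z ₁))) (H (x ₂) (H (y ₂) (z ₂)))       ≡⟨ inner-right x y z ⟨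
      product G H x (product G H y z)                                  ∎
  ; idˡ = λ x → trans (cong₂ pair (G.idˡ _) (H.idˡ _)) (pair-unpair x)
  ; idʳ = λ x → trans (cong₂ pair (G.idʳ _) (H.idʳ _)) (pair-unpair x)
  ; inv = λ x → let (y₁ , xy₁≡1 , yx₁≡1) = G.inv (x ₁) ; (y₂ , xy₂≡1 , yx₂≡1) = H.inv (x ₂) in
      pair y₁ y₂ ,
      trans (cong₂ (λ a b → pair (G (x ₁) a) (H (x ₂) b)) (unpair₁-pair y₁ y₂) (unpair₂-pair y₁ y₂)) (cong₂ pair xy₁≡1 xy₂≡1) ,
      trans (cong₂ (λ a b → pair (G a (x ₁)) (H b (x ₂))) (unpair₁-pair y₁ y₂) (unpair₂-pair y₁ y₂)) (cong₂ pair yx₁≡1 yx₂≡1)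
  }
  where
  module G = IsGroupTable G-grp
  module H = IsGroupTable H-grp
  open ≡-Reasoning
  _₁ _₂ : ℕ → ℕ
  _₁ = unpair₁
  _₂ = unpair₂
  inner-left : ∀ x y z → product G H (product G H x y) z ≡ pair (G (G (x ₁) (y ₁)) (z ₁)) (H (H (x ₂) (y ₂)) (z ₂))
  inner-left x y z = cong₂ (λ a b → pair (G a (z ₁)) (H b (z ₂))) (unpair₁-pair _ (H (x ₂) (y ₂))) (unpair₂-pair (G (x ₁) (y ₁)) _)
  inner-right : ∀ x y z → product G H x (product G H y z) ≡ pair (G (x ₁) (G (y ₁) (z ₁))) (H (x ₂) (H (y ₂) (z ₂)))
  inner-right x y z = cong₂ (λ a b → pair (G (x ₁) a) (H (x ₂) b)) (unpair₁-pair _ (H (y ₂) (z ₂))) (unpair₂-pair (G (y ₁) (z ₁)) _)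

-- Density of the shifted copies of a basic open set

Bounded : ℕ → Constraint → Set
Bounded m (i , j , k) = i ≤ m × j ≤ m × k ≤ m

Bounded-mono : ∀ {m m′} → m ≤ m′ → ∀ {t} → Bounded m t → Bounded m′ t
Bounded-mono m≤m′ (i≤m , j≤m , k≤m) = ≤-trans i≤m m≤m′ , ≤-trans j≤m m≤m′ , ≤-trans k≤m m≤m′

boundOf : List Constraint → ℕ
boundOf []                = 0
boundOf ((i , j , k) ∷ c) = i + (j + (k + boundOf c))

All-Bounded-boundOf : ∀ c → All (Bounded (boundOf c)) c
All-Bounded-boundOf []                = []
All-Bounded-boundOf ((i , j , k) ∷ c) =
  (m≤m+n i _ , ≤-trans (m≤m+n j _) (m≤n+m _ i) , ≤-trans (m≤m+n k _) (≤-trans (m≤n+m _ j) (m≤n+m _ i))) ∷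
  All-map (Bounded-mono (≤-trans (m≤n+m _ k) (≤-trans (m≤n+m _ j) (m≤n+m _ i)))) (All-Bounded-boundOf c)

shift : ℕ → ℕ → ℕ
shift m zero    = zero
shift m (suc i) = suc i + m

shift-injective : ∀ m {i j} → shift m i ≡ shift m j → i ≡ j
shift-injective m {zero}  {zero}  _  = refl
shift-injective m {suc i} {suc j} eq = trans (sym (m+n∸n≡m (suc i) m)) (trans (cong (_∸ m) eq) (m+n∸n≡m (suc j) m))

shiftPerm : ℕ → ℕ ↔ ℕ
shiftPerm m = proj₁ (extend-injection m (shift m) (λ _ _ → shift-injective m))

to-shiftPerm : ∀ m {i} → i ≤ m → to (shiftPerm m) i ≡ shift m i
to-shiftPerm m = proj₂ (extend-injection m (shift m) (λ _ _ → shift-injective m))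

-- Labels 0 … m go to the second factor of a product, labels m+1 … 2m to the first.
splitLabel : ℕ → ℕ → ℕ
splitLabel m i with i ≤? m
... | yes _ = pair 0 i
... | no  _ = pair (i ∸ m) 0

splitLabel-low : ∀ m {i} → i ≤ m → splitLabel m i ≡ pair 0 i
splitLabel-low m {i} i≤m with i ≤? m
... | yes _   = refl
... | no  i≰m = ⊥-elim (i≰m i≤m)

splitLabel-high : ∀ m {i} → ¬ i ≤ m → splitLabel m i ≡ pair (i ∸ m) 0
splitLabel-high m {i} i≰m with i ≤? m
... | yes i≤m = ⊥-elim (i≰m i≤m)
... | no  _   = refl

splitLabel-injective : ∀ m {i j} → splitLabel m i ≡ splitLabel m j → i ≡ j
splitLabel-injective m {i} {j} eq with i ≤? m | j ≤? m
... | yes _   | yes _   = proj₂ (pair-injective {0} {i} {0} {j} eq)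
... | yes _   | no  j≰m = ⊥-elim (j≰m (m∸n≡0⇒m≤n (sym (proj₁ (pair-injective {0} {i} {j ∸ m} {0} eq)))))
... | no  i≰m | yes _   = ⊥-elim (i≰m (m∸n≡0⇒m≤n (proj₁ (pair-injective {i ∸ m} {0} {0} {j} eq))))
... | no  i≰m | no  j≰m =
  trans (sym (m∸n+n≡m (<⇒≤ (≰⇒> i≰m)))) (trans (cong (_+ m) (proj₁ (pair-injective {i ∸ m} {0} {j ∸ m} {0} eq))) (m∸n+n≡m (<⇒≤ (≰⇒> j≰m))))

splitPerm : ℕ → ℕ ↔ ℕ
splitPerm m = proj₁ (extend-injection (m + m) (splitLabel m) (λ _ _ → splitLabel-injective m))

to-splitPerm : ∀ m {i} → i ≤ m + m → to (splitPerm m) i ≡ splitLabel m i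
to-splitPerm m = proj₂ (extend-injection (m + m) (splitLabel m) (λ _ _ → splitLabel-injective m))

splitPerm-low : ∀ m {i} → i ≤ m → to (splitPerm m) i ≡ pair 0 i
splitPerm-low m i≤m = trans (to-splitPerm m (≤-trans i≤m (m≤m+n m m))) (splitLabel-low m i≤m)

splitPerm-shiftPerm : ∀ m {i} → i ≤ m → to (splitPerm m) (to (shiftPerm m) i) ≡ pair i 0
splitPerm-shiftPerm m {zero}  i≤m rewrite to-shiftPerm m i≤m = splitPerm-low m z≤n
splitPerm-shiftPerm m {suc i} i≤m rewrite to-shiftPerm m i≤m =
  trans (to-splitPerm m (+-monoˡ-≤ m i≤m))
        (trans (splitLabel-high m 1+i+m≰m) (cong (λ a → pair a 0) (m+n∸n≡m (suc i) m)))
  where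
  1+i+m≰m : ¬ suc i + m ≤ m
  1+i+m≰m le = <-irrefl refl (≤-trans (s≤s (m≤n+m m i)) le)

-- Relabel a product of witnesses of c and c′ so that a shift of c lands in the
-- first factor and c′ in the second.
shifted-++-nonEmpty : ∀ {c c′} → NonEmptyIn𝒢 c → NonEmptyIn𝒢 c′ →
                      Σ ℕ λ m → NonEmptyIn𝒢 (map (relabel (to (shiftPerm m))) c ++ c′)
shifted-++-nonEmpty {c} {c′} (G , G-grp , G⊨c) (H , H-grp , H⊨c′) =
  m , act g P , act-isGroupTable g (splitPerm-low m z≤n) (product-isGroupTable G-grp H-grp) ,
  Equivalence.from (Meets-act g P _)
    (subst (λ d → Meets d P) (sym (map-++ _ (map (relabel (to σ)) c) c′))
           (++⁺ (map⁺ (map⁺ (All-map first (zip (bounds-c , G⊨c))))) (map⁺ (All-map second (zip (bounds-c′ , H⊨c′))))))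
  where
  m = boundOf c + boundOf c′
  g = splitPerm m
  σ = shiftPerm m
  P = product G H
  bounds-c : All (Bounded m) c
  bounds-c = All-map (Bounded-mono (m≤m+n _ _)) (All-Bounded-boundOf c)
  bounds-c′ : All (Bounded m) c′
  bounds-c′ = All-map (Bounded-mono (m≤n+m _ _)) (All-Bounded-boundOf c′)
  first : ∀ {t} → Bounded m t × Holds G t → Holds P (relabel (to g) (relabel (to σ) t))
  first {i , j , k} ((i≤m , j≤m , k≤m) , Gij≡k)
    rewrite splitPerm-shiftPerm m i≤m | splitPerm-shiftPerm m j≤m | splitPerm-shiftPerm m k≤m =
    trans (product-pair G H i 0 j 0) (cong₂ pair Gij≡k (IsGroupTable.idˡ H-grp 0))
  second : ∀ {t} → Bounded m t × Holds H t → Holds P (relabel (to g) t)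
  second {i , j , k} ((i≤m , j≤m , k≤m) , Hij≡k)
    rewrite splitPerm-low m i≤m | splitPerm-low m j≤m | splitPerm-low m k≤m =
    trans (product-pair G H 0 i 0 j) (cong₂ pair (IsGroupTable.idˡ G-grp 0) Hij≡k)

-- Topological zero-one law

zero-one-law : LEM → ∀ {S} → HasBaireProperty S →
               (∀ p → FixesIdentity p → ∀ G → S (act p G) → S G) →
               Meager S ⊎ Comeager S
zero-one-law lem {S} (O , S∖U , U∖S) invariant with lem (Σ (List Constraint) λ c → O c × NonEmptyIn𝒢 c)
... | inj₂ none =
  inj₁ (meager-mono (λ G grp s → s , λ (c , oc , G⊨c) → none (c , oc , G , grp , G⊨c)) S∖U)
... | inj₁ (c , oc , ne) =
  inj₂ (meager-mono cover (meager-∪ (meager-⋃ Shifted shifted-meager) (nowhereDense⇒meager avoid-nowhereDense)))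
  where
  shifted : ℕ → List Constraint
  shifted m = map (relabel (to (shiftPerm m))) c

  Shifted : ℕ → Table → Set
  Shifted m G = Meets (shifted m) G × ¬ S G

  shifted-meager : ∀ m → Meager (Shifted m)
  shifted-meager m =
    meager-mono (λ G _ (G⊨ , ¬s) → Equivalence.from (Meets-act σ G c) G⊨ , ¬s ∘ invariant σ fix G)
                (meager-act σ fix {λ G → Meets c G × ¬ S G} (meager-mono (λ _ _ (G⊨c , ¬s) → (c , oc , G⊨c) , ¬s) U∖S))
    where
    σ = shiftPerm m
    fix = to-shiftPerm m z≤n

  AvoidsShifts : Table → Set
  AvoidsShifts G = ¬ Σ ℕ λ m → Meets (shifted m) G

  avoid-nowhereDense : NowhereDense AvoidsShifts
  avoid-nowhereDense c′ ne′ with shifted-++-nonEmpty ne ne′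
  ... | m , ne″ = shifted m , ne″ , λ _ _ G⊨ avoid → avoid (m , ++⁻ˡ (shifted m) G⊨)

  cover : (λ G → ¬ S G) ⊆𝒢 (λ G → Σ ℕ (λ m → Shifted m G) ⊎ AvoidsShifts G)
  cover G _ ¬s with lem (Σ ℕ λ m → Meets (shifted m) G)
  ... | inj₁ (m , G⊨) = inj₁ (m , G⊨ , ¬s)
  ... | inj₂ avoid    = inj₂ avoid

mainTheorem10 : LEM →
    ((φ : Formula) (e : Assignment) → BorelIn𝒢 (λ G → Sat G e φ))
    × ((φ : Formula) → Sentence φ →
    Meager (λ G → Models G φ) ⊎ Comeager (λ G → Models G φ))
mainTheorem10 lem =
  (λ φ e → (λ G → Sat G e φ) , borel-Sat lem φ e , λ _ _ → mk⇔ id id) ,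
  λ φ _ → zero-one-law lem (borel⇒baire lem (borel-Sat lem φ (λ _ → e₁)))
                           (λ p fix G → Equivalence.to (Models-act p fix G φ))
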